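{- Let $F$ be an $n$-vertex 3-graph in which every vertex has degree at least $0.96\binom n2$, and let $U\subseteq V(F)$ be a set of at most $0.001n$ vertices. If $n$ is sufficiently large, then for any distinct $x,y,z\in U$ there is a sub-absorber in $F$ rooted at $x,y,z$ in which the only edges containing vertices of $U$ are the three rooted edges (those containing $x$, $y$ or $z$).
   Context: A sub-absorber rooted on distinct vertices $x,y,z$ is a set of five edges $\{x,x_1,x_2\},\{y,y_1,y_2\},\{z,z_1,z_2\},\{x_1,y_1,z_1\},\{x_2,y_2,z_2\}$ on 12 distinct vertices; its rooted edges are the three edges containing $x$, $y$ or $z$. The degree of a vertex is the number of edges containing it. -}

module Defs where

open import Data.Nat using (ℕ; _+_; _*_; _∸_; _<_)
open import Data.Bool using (Bool; true; false; if_then_else_)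
open import Data.Fin using (Fin; toℕ)
open import Data.Fin.Subset using (Subset; _∉_)
open import Data.List using (List; []; _∷_; map; concatMap; allFin)
open import Data.Nat.ListAction using (sum)
open import Data.List.Relation.Unary.Unique.Propositional using (Unique)
open import Data.Product using (_×_; ∃)
open import Relation.Nullary using (¬_)
open import Relation.Nullary.Decidable using (⌊_⌋)
open import Relation.Binary.PropositionalEquality using (_≡_)
open import Data.Nat.Properties using (_<?_)

-- A 3-graph (3-uniform hypergraph) on vertex set Fin n, given by the
-- indicator of its edges on ordered triples; the indicator is invariant
-- under permutations of the triple and only distinct triples are edges.
record ThreeGraph (n : ℕ) : Set where
  field
    edge     : Fin n → Fin n → Fin n → Bool
    sym₁₂    : ∀ a b c → edge a b c ≡ edge b a c
    sym₂₃    : ∀ a b c → edge a b c ≡ edge a c b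
    distinct : ∀ a b c → edge a b c ≡ true → ¬ a ≡ b × ¬ b ≡ c × ¬ a ≡ c
open ThreeGraph public

IsEdge : ∀ {n} → ThreeGraph n → Fin n → Fin n → Fin n → Set
IsEdge F a b c = edge F a b c ≡ true

degree : ∀ {n} → ThreeGraph n → Fin n → ℕ
degree {n} F v =
  sum (concatMap (λ a → map (λ b →
         if ⌊ toℕ a <? toℕ b ⌋ then (if edge F v a b then 1 else 0) else 0)
       (allFin n)) (allFin n))

record SubAbsorber {n} (F : ThreeGraph n) (x y z : Fin n) : Set where
  field
    x₁ x₂ y₁ y₂ z₁ z₂ : Fin n
    distinctVs : Unique (x ∷ y ∷ z ∷ x₁ ∷ x₂ ∷ y₁ ∷ y₂ ∷ z₁ ∷ z₂ ∷ [])
    ex  : IsEdge F x x₁ x₂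
    ey  : IsEdge F y y₁ y₂
    ez  : IsEdge F z z₁ z₂
    e₁  : IsEdge F x₁ y₁ z₁
    e₂  : IsEdge F x₂ y₂ z₂

-- The only edges of the sub-absorber meeting U are the rooted ones,
-- i.e. none of the non-root vertices lies in U.
AvoidsOutsideRoots : ∀ {n} {F : ThreeGraph n} {x y z : Fin n} →
                     SubAbsorber F x y z → Subset n → Set
AvoidsOutsideRoots S U =
  x₁ ∉ U × x₂ ∉ U × y₁ ∉ U × y₂ ∉ U × z₁ ∉ U × z₂ ∉ U
  where open SubAbsorber S

-- Call a vertex a low for v when at most n/4 vertices b have {v,a,b} ∉ F.  The degree
-- condition leaves every link with at most about n²/25 missing ordered pairs, so by
-- Markov's inequality at most n/2 vertices fail to be low for v.  Hence at least n/3
-- vertices lie outside U and are low for v, and, when w is low for v, at least n/3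
-- vertices outside U and off two prescribed vertices complete {v,w} to an edge.  Two
-- sets of n/3 vertices span n²/9 > n²/25 ordered pairs, so the link of any vertex
-- contains a pair from them.  Pick x₁ low for x, then an edge x₁y₁z₁ with y₁, z₁ low
-- for y, z; then x₂ completing xx₁ and an edge x₂y₂z₂ with y₂, z₂ completing yy₁, zz₁,
-- all outside U and avoiding x₁, y₁, z₁.
module Submission where

open import Defs
open import Data.Bool using (Bool; true; false; if_then_else_; not; _∨_)
import Data.Bool.Properties as Bool
open import Data.Fin using (Fin; zero; suc; toℕ)
open import Data.Fin.Properties using (_≟_; any?; toℕ-injective)
open import Data.Fin.Subset using (Subset; _∈_; _∉_; ∣_∣)
open import Data.Fin.Subset.Properties using (_∈?_)
open import Data.List using (List; []; _∷_; map; concatMap; tabulate)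
open import Data.Nat using (ℕ; zero; suc; _+_; _*_; _∸_; _≤_; _<_; _≥_; z≤n; s≤s; _≤?_; _<?_)
open import Data.Nat.Properties hiding (_≟_)
open import Data.Nat.Tactic.RingSolver using (solve)
import Data.Nat.ListAction as List
open import Data.Nat.ListAction.Properties using (sum-++)
open import Data.Product using (Σ; _×_; ∃; ∃₂; _,_; proj₁; proj₂)
import Data.Vec as Vec
open import Data.Sum using (inj₁; inj₂)
open import Function using (_∘_; id)
open import Level using (Level; 0ℓ)
open import Relation.Nullary using (¬_; Dec; yes; no; does; ¬?; _×-dec_; contradiction)
open import Relation.Nullary.Decidable using (⌊_⌋; dec-true; dec-false)
open import Relation.Unary using (Pred; Decidable; _∪_)
open import Relation.Unary.Properties using (_∪?_)
open import Relation.Binary.PropositionalEquality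
  using (_≡_; _≢_; refl; sym; trans; cong; cong₂; ≢-sym; module ≡-Reasoning)
open import Algebra.Properties.CommutativeMonoid.Sum +-0-commutativeMonoid
  using (sum; sum-syntax; sum-cong-≗; ∑-distrib-+; ∑-comm)
open import Algebra.Properties.Semiring.Sum +-*-semiring
  using (*-distribˡ-sum; *-distribʳ-sum)

ind : Bool → ℕ
ind b = if b then 1 else 0

∑-mono-≤ : ∀ {n} {f g : Fin n → ℕ} → (∀ i → f i ≤ g i) → sum f ≤ sum g
∑-mono-≤ {zero}  f≤g = z≤n
∑-mono-≤ {suc n} f≤g = +-mono-≤ (f≤g zero) (∑-mono-≤ (f≤g ∘ suc))

∑-const : ∀ n c → ∑[ i < n ] c ≡ n * c
∑-const zero    c = refl
∑-const (suc n) c = cong (c +_) (∑-const n c)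

sum-map-tabulate : ∀ {A : Set} {n} (g : A → ℕ) (f : Fin n → A) →
                   List.sum (map g (tabulate f)) ≡ ∑[ i < n ] g (f i)
sum-map-tabulate {n = zero}  g f = refl
sum-map-tabulate {n = suc n} g f = cong (g (f zero) +_) (sum-map-tabulate g (f ∘ suc))

sum-concatMap-tabulate : ∀ {A : Set} {n} (h : A → List ℕ) (f : Fin n → A) →
                         List.sum (concatMap h (tabulate f)) ≡ ∑[ i < n ] List.sum (h (f i))
sum-concatMap-tabulate {n = zero}  h f = refl
sum-concatMap-tabulate {n = suc n} h f =
  trans (sum-++ (h (f zero)) _) (cong (List.sum (h (f zero)) +_) (sum-concatMap-tabulate h (f ∘ suc)))

module _ {n : ℕ} {ℓ : Level} where

  -- `does` rather than `⌊_⌋`: only `does` computes through `Dec.map′`, as `count-≡`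
  -- and `count-∈` need.
  count : {P : Pred (Fin n) ℓ} → Decidable P → ℕ
  count P? = ∑[ i < n ] ind (does (P? i))

  count-all : {P : Pred (Fin n) ℓ} (P? : Decidable P) → (∀ i → P i) → n ≤ count P?
  count-all P? all = begin
    n               ≡⟨ sym (trans (∑-const n 1) (*-identityʳ n)) ⟩
    ∑[ i < n ] 1    ≤⟨ ∑-mono-≤ (λ i → ≤-reflexive (cong ind (sym (dec-true (P? i) (all i))))) ⟩
    count P?        ∎
    where open ≤-Reasoning

  count-witness : {P : Pred (Fin n) ℓ} (P? : Decidable P) → 0 < count P? → ∃ P
  count-witness P? pos with any? P?
  ... | yes found = found
  ... | no none   = contradiction (≤-trans pos (≤-trans (∑-mono-≤ absent) zeros)) λ ()
    where
    absent : ∀ i → ind (does (P? i)) ≤ 0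
    absent i = ≤-reflexive (cong ind (dec-false (P? i) (λ p → none (i , p))))
    zeros : ∑[ i < n ] 0 ≤ 0
    zeros = ≤-reflexive (trans (∑-const n 0) (*-zeroʳ n))

module _ {n : ℕ} {ℓ₁ ℓ₂ : Level} {P : Pred (Fin n) ℓ₁} {Q : Pred (Fin n) ℓ₂} where

  count-product : (P? : Decidable P) (Q? : Decidable Q) →
                  count P? * count Q? ≡ ∑[ i < n ] ∑[ j < n ] (ind (does (P? i)) * ind (does (Q? j)))
  count-product P? Q? =
    trans (*-distribʳ-sum (count Q?) (λ i → ind (does (P? i))))
          (sum-cong-≗ λ i → *-distribˡ-sum (ind (does (P? i))) (λ j → ind (does (Q? j))))

  count-∪ : (P? : Decidable P) (Q? : Decidable Q) → count (P? ∪? Q?) ≤ count P? + count Q?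
  count-∪ P? Q? =
    ≤-trans (∑-mono-≤ λ i → ind-∨ (does (P? i)) (does (Q? i)))
            (≤-reflexive (∑-distrib-+ (λ i → ind (does (P? i))) (λ i → ind (does (Q? i)))))
    where
    ind-∨ : ∀ p q → ind (p ∨ q) ≤ ind p + ind q
    ind-∨ true  q = s≤s z≤n
    ind-∨ false q = ≤-refl

  count-cover : (P? : Decidable P) (Q? : Decidable Q) → (∀ i → (P ∪ Q) i) → n ≤ count P? + count Q?
  count-cover P? Q? cover = ≤-trans (count-all (P? ∪? Q?) cover) (count-∪ P? Q?)

count-≡ : ∀ {n} (j : Fin n) → count (_≟ j) ≡ 1
count-≡ {suc n} zero    = cong suc (trans (∑-const n 0) (*-zeroʳ n))
count-≡ {suc n} (suc j) = count-≡ j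

count-∈ : ∀ {n} (U : Subset n) → count (_∈? U) ≡ ∣ U ∣
count-∈ Vec.[]          = refl
count-∈ (true Vec.∷ U)  = cong suc (count-∈ U)
count-∈ (false Vec.∷ U) = count-∈ U

markov : ∀ {n} (f : Fin n → ℕ) t → count (λ i → t <? f i) * suc t ≤ ∑[ i < n ] f i
markov f t =
  ≤-trans (≤-reflexive (*-distribʳ-sum (suc t) (λ i → ind (does (t <? f i)))))
          (∑-mono-≤ λ i → weight (t <? f i))
  where
  weight : ∀ {m} (t<m? : Dec (t < m)) → ind (does t<m?) * suc t ≤ m
  weight (yes t<m) = ≤-trans (≤-reflexive (*-identityˡ (suc t))) t<m
  weight (no  _)   = z≤n

module _ {n : ℕ} (F : ThreeGraph n) where

  isEdge? : ∀ a b c → Dec (IsEdge F a b c)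
  isEdge? a b c = edge F a b c Bool.≟ true

  linkNonDegree : Fin n → Fin n → ℕ
  linkNonDegree v a = count (λ b → ¬? (isEdge? v a b))

  -- Counts ordered pairs, so each non-edge {a,b} of the link twice and each loop (a,a) once.
  linkNonEdges : Fin n → ℕ
  linkNonEdges v = ∑[ a < n ] linkNonDegree v a

  private
    orderedEdge : Fin n → Fin n → Fin n → ℕ
    orderedEdge v a b = if ⌊ toℕ a <? toℕ b ⌋ then ind (edge F v a b) else 0

    degree≡∑orderedEdge : ∀ v → degree F v ≡ ∑[ a < n ] ∑[ b < n ] orderedEdge v a b
    degree≡∑orderedEdge v =
      trans (sum-concatMap-tabulate (λ a → map (orderedEdge v a) (tabulate id)) id)
            (sum-cong-≗ {n} λ a → sum-map-tabulate (orderedEdge v a) id)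

    no-loop : ∀ v a → ind (edge F v a a) ≡ 0
    no-loop v a with edge F v a a in e
    ... | true  = contradiction refl (proj₁ (proj₂ (distinct F v a a e)))
    ... | false = refl

    edge≡orderedEdge+orderedEdge : ∀ v a b → ind (edge F v a b) ≡ orderedEdge v a b + orderedEdge v b a
    edge≡orderedEdge+orderedEdge v a b with toℕ a <? toℕ b | toℕ b <? toℕ a
    ... | yes a<b | yes b<a = contradiction b<a (<-asym a<b)
    ... | yes _   | no  _   = sym (+-identityʳ _)
    ... | no  _   | yes _   = cong ind (sym₂₃ F v a b)
    ... | no  a≮b | no  b≮a with toℕ-injective (≤-antisym (≮⇒≥ b≮a) (≮⇒≥ a≮b))
    ...   | refl = no-loop v a

  ∑-link≡2*degree : ∀ v → ∑[ a < n ] ∑[ b < n ] ind (edge F v a b) ≡ 2 * degree F v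
  ∑-link≡2*degree v = begin
    ∑[ a < n ] ∑[ b < n ] ind (edge F v a b)
      ≡⟨ sum-cong-≗ (λ a → trans (sum-cong-≗ (edge≡orderedEdge+orderedEdge v a))
                                 (∑-distrib-+ (orderedEdge v a) (λ b → orderedEdge v b a))) ⟩
    ∑[ a < n ] (∑[ b < n ] orderedEdge v a b + ∑[ b < n ] orderedEdge v b a)
      ≡⟨ ∑-distrib-+ (λ a → ∑[ b < n ] orderedEdge v a b) (λ a → ∑[ b < n ] orderedEdge v b a) ⟩
    ∑[ a < n ] ∑[ b < n ] orderedEdge v a b + ∑[ a < n ] ∑[ b < n ] orderedEdge v b a
      ≡⟨ cong (∑[ a < n ] ∑[ b < n ] orderedEdge v a b +_) (∑-comm (λ a b → orderedEdge v b a)) ⟩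
    ∑[ a < n ] ∑[ b < n ] orderedEdge v a b + ∑[ a < n ] ∑[ b < n ] orderedEdge v a b
      ≡⟨ cong (λ d → d + d) (sym (degree≡∑orderedEdge v)) ⟩
    degree F v + degree F v
      ≡⟨ cong (degree F v +_) (sym (+-identityʳ _)) ⟩
    2 * degree F v ∎
    where open ≡-Reasoning

  linkNonEdges+2*degree : ∀ v → linkNonEdges v + 2 * degree F v ≡ n * n
  linkNonEdges+2*degree v = begin
    linkNonEdges v + 2 * degree F v
      ≡⟨ cong (linkNonEdges v +_) (sym (∑-link≡2*degree v)) ⟩
    linkNonEdges v + ∑[ a < n ] ∑[ b < n ] ind (edge F v a b)
      ≡⟨ sym (∑-distrib-+ (linkNonDegree v) (λ a → ∑[ b < n ] ind (edge F v a b))) ⟩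
    ∑[ a < n ] (linkNonDegree v a + ∑[ b < n ] ind (edge F v a b))
      ≡⟨ sum-cong-≗ (λ a → trans (sym (∑-distrib-+ _ (λ b → ind (edge F v a b))))
                                 (sum-cong-≗ λ b → non-edge+edge (edge F v a b))) ⟩
    ∑[ a < n ] ∑[ b < n ] 1
      ≡⟨ sum-cong-≗ {n} (λ _ → ∑-const n 1) ⟩
    ∑[ a < n ] (n * 1)
      ≡⟨ ∑-const n (n * 1) ⟩
    n * (n * 1)
      ≡⟨ cong (n *_) (*-identityʳ n) ⟩
    n * n ∎
    where
    open ≡-Reasoning
    non-edge+edge : ∀ e → ind (does (¬? (e Bool.≟ true))) + ind e ≡ 1
    non-edge+edge true  = refl
    non-edge+edge false = refl

  edge-across : ∀ {ℓ₁ ℓ₂} {P : Pred (Fin n) ℓ₁} {Q : Pred (Fin n) ℓ₂}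
                (P? : Decidable P) (Q? : Decidable Q) a →
                linkNonEdges a < count P? * count Q? → ∃₂ λ b c → P b × Q c × IsEdge F a b c
  edge-across P? Q? a few with any? (λ b → any? (λ c → P? b ×-dec Q? c ×-dec isEdge? a b c))
  ... | yes (b , c , found) = b , c , found
  ... | no none = contradiction few (≤⇒≯ (begin
    count P? * count Q?
      ≡⟨ count-product P? Q? ⟩
    ∑[ b < n ] ∑[ c < n ] (ind (does (P? b)) * ind (does (Q? c)))
      ≤⟨ ∑-mono-≤ (λ b → ∑-mono-≤ λ c →
           non-edge (P? b) (Q? c) (isEdge? a b c) (λ e → none (b , c , e))) ⟩
    linkNonEdges a ∎))
    where
    open ≤-Reasoning
    non-edge : ∀ {ℓ ℓ′} {B : Set ℓ} {C : Set ℓ′} {E : Set} (B? : Dec B) (C? : Dec C) (E? : Dec E) →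
               ¬ (B × C × E) → ind (does B?) * ind (does C?) ≤ ind (does (¬? E?))
    non-edge (yes b) (yes c) (yes e) none = contradiction (b , c , e) none
    non-edge (yes _) (yes _) (no  _) _    = ≤-refl
    non-edge (yes _) (no  _) _       _    = z≤n
    non-edge (no  _) _       _       _    = z≤n

n*[n∸1]+n≡n*n : ∀ n → n * (n ∸ 1) + n ≡ n * n
n*[n∸1]+n≡n*n zero    = refl
n*[n∸1]+n≡n*n n@(suc m) = trans (+-comm (n * m) n) (sym (*-suc n m))

sparse-link : ∀ n N d → N + 2 * d ≡ n * n → 96 * (n * (n ∸ 1)) ≤ 200 * d → 25 * N ≤ n * n + 25 * n
sparse-link n N d N+2d≡n*n dense =
  ≤-trans (bound (n * (n ∸ 1)) (trans N+2d≡n*n (sym (n*[n∸1]+n≡n*n n))) dense)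
          (+-monoˡ-≤ (25 * n) (*-monoʳ-≤ n (m∸n≤m n 1)))
  where
  bound : ∀ P → N + 2 * d ≡ P + n → 96 * P ≤ 200 * d → 25 * N ≤ P + 25 * n
  bound P eq dense = *-cancelˡ-≤ 4 (+-cancelʳ-≤ (96 * P) _ _ (begin
    4 * (25 * N) + 96 * P   ≤⟨ +-monoʳ-≤ (4 * (25 * N)) dense ⟩
    4 * (25 * N) + 200 * d  ≡⟨ solve (N ∷ d ∷ []) ⟩
    100 * (N + 2 * d)       ≡⟨ cong (100 *_) eq ⟩
    100 * (P + n)           ≡⟨ solve (P ∷ n ∷ []) ⟩
    4 * (P + 25 * n) + 96 * P ∎))
    where open ≤-Reasoning

few-exceptions : ∀ n N b → 12 ≤ n → 25 * N ≤ n * n + 25 * n → b * suc n ≤ 4 * N → 2 * b ≤ n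
few-exceptions n N b n≥12 sparse b-bound = *-cancelˡ-≤ 25 (begin
    25 * (2 * b)     ≡⟨ solve (b ∷ []) ⟩
    2 * (25 * b)     ≤⟨ *-monoʳ-≤ 2 25b≤4n+100 ⟩
    2 * (4 * n + 100) ≡⟨ solve (n ∷ []) ⟩
    8 * n + 200      ≤⟨ +-monoʳ-≤ (8 * n) (≤-trans (m≤m+n 200 4) (*-monoʳ-≤ 17 n≥12)) ⟩
    8 * n + 17 * n   ≡⟨ solve (n ∷ []) ⟩
    25 * n           ∎)
  where
  open ≤-Reasoning
  25b≤4n+100 : 25 * b ≤ 4 * n + 100
  25b≤4n+100 = *-cancelʳ-≤ (25 * b) (4 * n + 100) (suc n) (begin
    25 * b * suc n             ≡⟨ *-assoc 25 b (suc n) ⟩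
    25 * (b * suc n)           ≤⟨ *-monoʳ-≤ 25 b-bound ⟩
    25 * (4 * N)               ≡⟨ solve (N ∷ []) ⟩
    4 * (25 * N)               ≤⟨ *-monoʳ-≤ 4 sparse ⟩
    4 * (n * n + 25 * n)       ≤⟨ m≤m+n _ (4 * n + 100) ⟩
    4 * (n * n + 25 * n) + (4 * n + 100) ≡⟨ solve (n ∷ []) ⟩
    (4 * n + 100) * suc n      ∎)

at-least-third : ∀ n c u r → n ≤ c + (u + r) → 6 * u ≤ n → 2 * r ≤ n → n ≤ 3 * c
at-least-third n c u r covered small few =
  *-cancelˡ-≤ 2 (+-cancelʳ-≤ (4 * n) (2 * n) (2 * (3 * c)) (begin
    2 * n + 4 * n                 ≡⟨ solve (n ∷ []) ⟩
    6 * n                         ≤⟨ *-monoʳ-≤ 6 covered ⟩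
    6 * (c + (u + r))             ≡⟨ solve (c ∷ u ∷ r ∷ []) ⟩
    6 * c + (6 * u + 3 * (2 * r)) ≤⟨ +-monoʳ-≤ (6 * c) (+-mono-≤ small (*-monoʳ-≤ 3 few)) ⟩
    6 * c + (n + 3 * n)           ≡⟨ solve (c ∷ n ∷ []) ⟩
    2 * (3 * c) + 4 * n           ∎))
  where open ≤-Reasoning

two-plus-small : ∀ n D → 8 ≤ n → 4 * D ≤ n → 2 * (1 + (1 + D)) ≤ n
two-plus-small n D n≥8 small = *-cancelˡ-≤ 4 (begin
    4 * (2 * (1 + (1 + D)))  ≡⟨ solve (D ∷ []) ⟩
    2 * 8 + 2 * (4 * D)      ≤⟨ +-mono-≤ (*-monoʳ-≤ 2 n≥8) (*-monoʳ-≤ 2 small) ⟩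
    2 * n + 2 * n            ≡⟨ solve (n ∷ []) ⟩
    4 * n                    ∎)
  where open ≤-Reasoning

sparse<product : ∀ n N b c → 15 ≤ n → 25 * N ≤ n * n + 25 * n → n ≤ 3 * b → n ≤ 3 * c → N < b * c
sparse<product n N b c n≥15 sparse large-b large-c = *-cancelˡ-≤ 225 (begin
    225 * suc N                     ≡⟨ solve (N ∷ []) ⟩
    9 * (25 * N) + 225              ≤⟨ +-monoˡ-≤ 225 (*-monoʳ-≤ 9 sparse) ⟩
    9 * (n * n + 25 * n) + 225      ≡⟨ solve (n ∷ []) ⟩
    9 * (n * n) + (225 * n + 225)   ≤⟨ +-monoʳ-≤ (9 * (n * n)) (+-monoʳ-≤ (225 * n) (*-monoʳ-≤ 15 n≥15)) ⟩
    9 * (n * n) + (225 * n + 15 * n) ≡⟨ solve (n ∷ []) ⟩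
    9 * (n * n) + 16 * (15 * n)     ≤⟨ +-monoʳ-≤ (9 * (n * n)) (*-monoʳ-≤ 16 (*-monoˡ-≤ n n≥15)) ⟩
    9 * (n * n) + 16 * (n * n)      ≡⟨ solve (n ∷ []) ⟩
    25 * (n * n)                    ≤⟨ *-monoʳ-≤ 25 (*-mono-≤ large-b large-c) ⟩
    25 * (3 * b * (3 * c))          ≡⟨ solve (b ∷ c ∷ []) ⟩
    225 * (b * c)                   ∎)
  where open ≤-Reasoning

third-positive : ∀ {n} c → 0 < n → n ≤ 3 * c → 0 < c
third-positive zero    0<n n≤0 = contradiction (≤-trans 0<n n≤0) λ ()
third-positive (suc c) _   _   = s≤s z≤n

module _ {n : ℕ} (F : ThreeGraph n) (U : Subset n) (n≥15 : 15 ≤ n) (small : 6 * ∣ U ∣ ≤ n)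
         (mindeg : ∀ v → 96 * (n * (n ∸ 1)) ≤ 200 * degree F v) where

  open import Data.List.Relation.Unary.All using (All; []; _∷_)
  open import Data.List.Relation.Unary.AllPairs using ([]; _∷_)
  open import Data.List.Relation.Unary.Unique.Propositional using (Unique)

  Large : ∀ {ℓ} {P : Pred (Fin n) ℓ} → Decidable P → Set
  Large P? = n ≤ 3 * count P?

  sparse : ∀ v → 25 * linkNonEdges F v ≤ n * n + 25 * n
  sparse v = sparse-link n (linkNonEdges F v) (degree F v) (linkNonEdges+2*degree F v) (mindeg v)

  element : ∀ {ℓ} {P : Pred (Fin n) ℓ} (P? : Decidable P) → Large P? → ∃ P
  element P? large = count-witness P? (third-positive (count P?) (≤-trans (s≤s z≤n) n≥15) large)

  edge-between : ∀ {ℓ₁ ℓ₂} {P : Pred (Fin n) ℓ₁} {Q : Pred (Fin n) ℓ₂}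
                 (P? : Decidable P) (Q? : Decidable Q) →
                 Large P? → Large Q? → ∀ a → ∃₂ λ b c → P b × Q c × IsEdge F a b c
  edge-between P? Q? P-large Q-large a =
    edge-across F P? Q? a
      (sparse<product n (linkNonEdges F a) (count P?) (count Q?) n≥15 (sparse a) P-large Q-large)

  Low : Fin n → Fin n → Set
  Low v a = 4 * linkNonDegree F v a ≤ n

  FirstChoice : Fin n → Pred (Fin n) 0ℓ
  FirstChoice v a = a ∉ U × Low v a

  firstChoice? : ∀ v → Decidable (FirstChoice v)
  firstChoice? v a = ¬? (a ∈? U) ×-dec (4 * linkNonDegree F v a ≤? n)

  firstChoice-large : ∀ v → Large (firstChoice? v)
  firstChoice-large v = at-least-third n chosen ∣ U ∣ (count high?) covered small
    (few-exceptions n (linkNonEdges F v) (count high?) (≤-trans (m≤m+n 12 3) n≥15) (sparse v)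
      (≤-trans (markov (λ a → 4 * linkNonDegree F v a) n)
               (≤-reflexive (sym (*-distribˡ-sum 4 (linkNonDegree F v))))))
    where
    High : Pred (Fin n) 0ℓ
    High a = n < 4 * linkNonDegree F v a
    high? : Decidable High
    high? a = n <? 4 * linkNonDegree F v a
    cover : ∀ a → (FirstChoice v ∪ ((_∈ U) ∪ High)) a
    cover a with a ∈? U | 4 * linkNonDegree F v a ≤? n
    ... | yes a∈U | _        = inj₂ (inj₁ a∈U)
    ... | no  a∉U | yes low  = inj₁ (a∉U , low)
    ... | no  _   | no  high = inj₂ (inj₂ (≰⇒> high))
    chosen : ℕ
    chosen = count (firstChoice? v)
    covered : n ≤ chosen + (∣ U ∣ + count high?)
    covered = begin
      n                                        ≤⟨ count-cover (firstChoice? v) ((_∈? U) ∪? high?) cover ⟩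
      chosen + count ((_∈? U) ∪? high?)        ≤⟨ +-monoʳ-≤ chosen (count-∪ (_∈? U) high?) ⟩
      chosen + (count (_∈? U) + count high?)   ≡⟨ cong (λ k → chosen + (k + count high?)) (count-∈ U) ⟩
      chosen + (∣ U ∣ + count high?)           ∎
      where open ≤-Reasoning

  SecondChoice : (v w p q : Fin n) → Pred (Fin n) 0ℓ
  SecondChoice v w p q a = IsEdge F v w a × a ∉ U × a ≢ p × a ≢ q

  secondChoice? : ∀ v w p q → Decidable (SecondChoice v w p q)
  secondChoice? v w p q a = isEdge? F v w a ×-dec ¬? (a ∈? U) ×-dec ¬? (a ≟ p) ×-dec ¬? (a ≟ q)

  secondChoice-large : ∀ v w p q → Low v w → Large (secondChoice? v w p q)
  secondChoice-large v w p q low =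
    at-least-third n chosen ∣ U ∣ (1 + (1 + linkNonDegree F v w)) covered small
      (two-plus-small n (linkNonDegree F v w) (≤-trans (m≤m+n 8 7) n≥15) low)
    where
    NonEdge : Pred (Fin n) 0ℓ
    NonEdge a = ¬ IsEdge F v w a
    nonEdge? : Decidable NonEdge
    nonEdge? a = ¬? (isEdge? F v w a)
    cover : ∀ a → (SecondChoice v w p q ∪ ((_∈ U) ∪ ((_≡ p) ∪ ((_≡ q) ∪ NonEdge)))) a
    cover a with isEdge? F v w a | a ∈? U | a ≟ p | a ≟ q
    ... | no  ¬e | _       | _       | _       = inj₂ (inj₂ (inj₂ (inj₂ ¬e)))
    ... | yes _  | yes a∈U | _       | _       = inj₂ (inj₁ a∈U)
    ... | yes _  | no  _   | yes a≡p | _       = inj₂ (inj₂ (inj₁ a≡p))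
    ... | yes _  | no  _   | no  _   | yes a≡q = inj₂ (inj₂ (inj₂ (inj₁ a≡q)))
    ... | yes e  | no  a∉U | no  a≢p | no  a≢q = inj₁ (e , a∉U , a≢p , a≢q)
    chosen : ℕ
    chosen = count (secondChoice? v w p q)
    covered : n ≤ chosen + (∣ U ∣ + (1 + (1 + linkNonDegree F v w)))
    covered = begin
      n
        ≤⟨ count-cover (secondChoice? v w p q) ((_∈? U) ∪? (_≟ p) ∪? (_≟ q) ∪? nonEdge?) cover ⟩
      chosen + count ((_∈? U) ∪? (_≟ p) ∪? (_≟ q) ∪? nonEdge?)
        ≤⟨ +-monoʳ-≤ chosen (≤-trans (count-∪ (_∈? U) ((_≟ p) ∪? (_≟ q) ∪? nonEdge?))
             (+-monoʳ-≤ (count (_∈? U)) (≤-trans (count-∪ (_≟ p) ((_≟ q) ∪? nonEdge?))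
               (+-monoʳ-≤ (count (_≟ p)) (count-∪ (_≟ q) nonEdge?))))) ⟩
      chosen + (count (_∈? U) + (count (_≟ p) + (count (_≟ q) + count nonEdge?)))
        ≡⟨ cong₂ (λ k l → chosen + (k + l)) (count-∈ U)
                 (cong₂ (λ s t → s + (t + count nonEdge?)) (count-≡ p) (count-≡ q)) ⟩
      chosen + (∣ U ∣ + (1 + (1 + linkNonDegree F v w))) ∎
      where open ≤-Reasoning

  sub-absorber-of-edges :
    ∀ {x y z x₁ x₂ y₁ y₂ z₁ z₂} → x ∈ U → y ∈ U → z ∈ U → x ≢ y → y ≢ z → x ≢ z →
    x₁ ∉ U → x₂ ∉ U → y₁ ∉ U → y₂ ∉ U → z₁ ∉ U → z₂ ∉ U →
    x₂ ≢ y₁ → x₂ ≢ z₁ → y₂ ≢ x₁ → y₂ ≢ z₁ → z₂ ≢ x₁ → z₂ ≢ y₁ →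
    IsEdge F x x₁ x₂ → IsEdge F y y₁ y₂ → IsEdge F z z₁ z₂ → IsEdge F x₁ y₁ z₁ → IsEdge F x₂ y₂ z₂ →
    Σ (SubAbsorber F x y z) (λ S → AvoidsOutsideRoots S U)
  sub-absorber-of-edges {x} {y} {z} {x₁} {x₂} {y₁} {y₂} {z₁} {z₂} x∈U y∈U z∈U x≢y y≢z x≢z
                        x₁∉U x₂∉U y₁∉U y₂∉U z₁∉U z₂∉U x₂≢y₁ x₂≢z₁ y₂≢x₁ y₂≢z₁ z₂≢x₁ z₂≢y₁
                        ex ey ez e₁ e₂ =
    record { x₁ = x₁ ; x₂ = x₂ ; y₁ = y₁ ; y₂ = y₂ ; z₁ = z₁ ; z₂ = z₂
           ; distinctVs = all-distinct ; ex = ex ; ey = ey ; ez = ez ; e₁ = e₁ ; e₂ = e₂ }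
    , x₁∉U , x₂∉U , y₁∉U , y₂∉U , z₁∉U , z₂∉U
    where
    ∈-∉-apart : ∀ {r a} → r ∈ U → a ∉ U → r ≢ a
    ∈-∉-apart r∈U a∉U refl = a∉U r∈U
    apart : ∀ {r} → r ∈ U → All (r ≢_) (x₁ ∷ x₂ ∷ y₁ ∷ y₂ ∷ z₁ ∷ z₂ ∷ [])
    apart r∈U = ∈-∉-apart r∈U x₁∉U ∷ ∈-∉-apart r∈U x₂∉U ∷ ∈-∉-apart r∈U y₁∉U
              ∷ ∈-∉-apart r∈U y₂∉U ∷ ∈-∉-apart r∈U z₁∉U ∷ ∈-∉-apart r∈U z₂∉U ∷ []
    x₁≢x₂ : x₁ ≢ x₂
    x₁≢x₂ = proj₁ (proj₂ (distinct F x x₁ x₂ ex))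
    y₁≢y₂ : y₁ ≢ y₂
    y₁≢y₂ = proj₁ (proj₂ (distinct F y y₁ y₂ ey))
    z₁≢z₂ : z₁ ≢ z₂
    z₁≢z₂ = proj₁ (proj₂ (distinct F z z₁ z₂ ez))
    all-distinct : Unique (x ∷ y ∷ z ∷ x₁ ∷ x₂ ∷ y₁ ∷ y₂ ∷ z₁ ∷ z₂ ∷ [])
    all-distinct with distinct F x₁ y₁ z₁ e₁ | distinct F x₂ y₂ z₂ e₂
    ... | x₁≢y₁ , y₁≢z₁ , x₁≢z₁ | x₂≢y₂ , y₂≢z₂ , x₂≢z₂ =
        (x≢y ∷ x≢z ∷ apart x∈U) ∷ (y≢z ∷ apart y∈U) ∷ apart z∈U
      ∷ (x₁≢x₂ ∷ x₁≢y₁ ∷ ≢-sym y₂≢x₁ ∷ x₁≢z₁ ∷ ≢-sym z₂≢x₁ ∷ [])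
      ∷ (x₂≢y₁ ∷ x₂≢y₂ ∷ x₂≢z₁ ∷ x₂≢z₂ ∷ [])
      ∷ (y₁≢y₂ ∷ y₁≢z₁ ∷ ≢-sym z₂≢y₁ ∷ [])
      ∷ (y₂≢z₁ ∷ y₂≢z₂ ∷ [])
      ∷ (z₁≢z₂ ∷ [])
      ∷ [] ∷ []

  sub-absorber : ∀ x y z → x ∈ U → y ∈ U → z ∈ U → x ≢ y → y ≢ z → x ≢ z →
                 Σ (SubAbsorber F x y z) (λ S → AvoidsOutsideRoots S U)
  sub-absorber x y z x∈U y∈U z∈U x≢y y≢z x≢z =
    let x₁ , x₁∉U , x₁-low = element (firstChoice? x) (firstChoice-large x)
        y₁ , z₁ , (y₁∉U , y₁-low) , (z₁∉U , z₁-low) , e₁ =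
          edge-between (firstChoice? y) (firstChoice? z) (firstChoice-large y) (firstChoice-large z) x₁
        x₂ , ex , x₂∉U , x₂≢y₁ , x₂≢z₁ =
          element (secondChoice? x x₁ y₁ z₁) (secondChoice-large x x₁ y₁ z₁ x₁-low)
        y₂ , z₂ , (ey , y₂∉U , y₂≢x₁ , y₂≢z₁) , (ez , z₂∉U , z₂≢x₁ , z₂≢y₁) , e₂ =
          edge-between (secondChoice? y y₁ x₁ z₁) (secondChoice? z z₁ x₁ y₁)
                       (secondChoice-large y y₁ x₁ z₁ y₁-low) (secondChoice-large z z₁ x₁ y₁ z₁-low) x₂
    in sub-absorber-of-edges x∈U y∈U z∈U x≢y y≢z x≢z x₁∉U x₂∉U y₁∉U y₂∉U z₁∉U z₂∉U
                             x₂≢y₁ x₂≢z₁ y₂≢x₁ y₂≢z₁ z₂≢x₁ z₂≢y₁ ex ey ez e₁ e₂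

lemma7p7 : ∃ λ n₀ → ∀ n → n ≥ n₀ →
    (F : ThreeGraph n) →
    (∀ v → 96 * (n * (n ∸ 1)) ≤ 200 * degree F v) →
    (U : Subset n) → 1000 * ∣ U ∣ ≤ n →
    (x y z : Fin n) → x ∈ U → y ∈ U → z ∈ U →
    ¬ x ≡ y → ¬ y ≡ z → ¬ x ≡ z →
    Σ (SubAbsorber F x y z) (λ S → AvoidsOutsideRoots S U)
lemma7p7 = 15 , λ n n≥15 F mindeg U 1000∣U∣≤n →
  sub-absorber F U n≥15 (≤-trans (*-monoˡ-≤ ∣ U ∣ (m≤m+n 6 994)) 1000∣U∣≤n) mindeg
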